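{- Let $k$ be a positive integer, let $D=\{d_1,\ldots,d_n\}$ be a multiset of positive integers, let $S$ be a feasible $k$-Visits schedule for $D$, and let $m=\prod_{i=1}^n d_i$. If, for every $i\in[n]$, the $k$-th visit of task $i$ in $S$ occurs at a position no earlier than $m+1$, then there exist positions $p\leq p'$ in $[m]$ such that the infinite sequence obtained by repeating the contiguous subsequence $S[p,p']$ (positions $p$ through $p'$ of $S$) forever is a feasible Pinwheel Scheduling schedule for $D$.
   Context: $k$-Visits: for deadlines $D=\{d_1,\ldots,d_n\}$, a feasible schedule is a sequence of length $nk$ with entries in $[n]$ (the entry at a position is the task visited there), containing each $i$ exactly $k$ times, such that the first occurrence of $i$ is within the first $d_i$ positions and every later occurrence of $i$ is at most $d_i$ positions after the previous occurrence of $i$. Pinwheel Scheduling: an infinite sequence $p_1,p_2,\ldots$ with entries in $[n]$ is a feasible schedule for $D$ if for every $i\in[n]$ any $d_i$ consecutive entries contain at least one occurrence of $i$. -}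

module Defs where

open import Data.Nat using (ℕ; zero; suc; _+_; _*_; _∸_; _≤_; _<_; _≤?_)
open import Data.Nat.Properties using (m+[n∸m]≡n; +-monoʳ-≤; ≤-<-trans; ≤-trans; ≤-refl)
open import Data.Nat.DivMod using (_%_; m%n<n)
open import Data.Fin using (Fin; toℕ; fromℕ<; _≟_)
open import Data.List using (List; length; filter; map; allFin)
open import Data.Nat.ListAction using (product)
open import Data.Product using (∃; _×_; _,_)
open import Relation.Nullary using (¬_)
open import Relation.Nullary.Decidable using (_×-dec_)
open import Relation.Binary.PropositionalEquality using (_≡_; subst)

-- Conventions: a schedule of length L over tasks [n] is a function
-- s : Fin L → Fin n ; index j (0-based) is position toℕ j + 1 (1-based).

visits : {n L : ℕ} → (Fin L → Fin n) → Fin n → ℕ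
visits {L = L} s i = length (filter (λ j → s j ≟ i) (allFin L))

visitsUpTo : {n L : ℕ} → (Fin L → Fin n) → Fin n → Fin L → ℕ
visitsUpTo {L = L} s i j =
  length (filter (λ j' → (toℕ j' ≤? toℕ j) ×-dec (s j' ≟ i)) (allFin L))

record KVisitsFeasible (n k : ℕ) (d : Fin n → ℕ) (s : Fin (n * k) → Fin n) : Set where
  field
    exactlyK : ∀ i → visits s i ≡ k
    firstWithin : ∀ i → (j : Fin (n * k)) → s j ≡ i →
      (∀ (j' : Fin (n * k)) → toℕ j' Data.Nat.< toℕ j → ¬ (s j' ≡ i)) →
      suc (toℕ j) ≤ d i
    gapWithin : ∀ i → (j j' : Fin (n * k)) → s j ≡ i → s j' ≡ i →
      toℕ j < toℕ j' →
      (∀ (j'' : Fin (n * k)) → toℕ j < toℕ j'' → toℕ j'' < toℕ j' → ¬ (s j'' ≡ i)) →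
      toℕ j' ≤ toℕ j + d i

prodD : (n : ℕ) → (Fin n → ℕ) → ℕ
prodD n d = product (map d (allFin n))

-- feasible Pinwheel schedule (0-based indexing of the infinite sequence):
-- any d i consecutive entries contain task i
PinwheelFeasible : (n : ℕ) → (Fin n → ℕ) → (ℕ → Fin n) → Set
PinwheelFeasible n d σ =
  ∀ (i : Fin n) (start : ℕ) → ∃ λ t → start ≤ t × t < start + d i × σ t ≡ i

-- index of the t-th entry (0-based) of the infinite repetition of the
-- segment of indices p..q (0-based, inclusive)
segIdx : ℕ → ℕ → ℕ → ℕ
segIdx p q t = p + t % suc (q ∸ p)

segIdx≤ : ∀ p q t → p ≤ q → segIdx p q t ≤ q
segIdx≤ p q t p≤q =
  subst (λ x → p + t % suc (q ∸ p) ≤ x) (m+[n∸m]≡n p≤q)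
    (+-monoʳ-≤ p (pred≤ (m%n<n t (suc (q ∸ p)))))
  where
  pred≤ : ∀ {a b} → a < suc b → a ≤ b
  pred≤ (Data.Nat.s≤s x) = x

repeatSeg : {n L : ℕ} → (Fin L → Fin n) → (p q : ℕ) → p ≤ q → q < L → ℕ → Fin n
repeatSeg s p q p≤q q<L t = s (fromℕ< (≤-<-trans (segIdx≤ p q t p≤q) q<L))

{-# OPTIONS --safe #-}
module Submission where

-- For t ≤ m every task still has a visit at or after position t (its k-th visit comes after m),
-- and the deadline constraints put the first such visit less than d i positions after t.
-- The vector of these offsets, the state at t, takes at most m = ∏ d i values, so two times
-- p < b ≤ m share a state. Repeating S[p .. b-1] is then a pinwheel schedule: from p + r the next
-- visit of i is either still inside the segment, or it lies past b, in which case the visit at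
-- p + y, for y the common offset at p and b, repeated one period later comes no later.

open import Defs
open import Level using (Level; 0ℓ)
open import Function using (_∘_; id)
open import Data.Nat
  using (ℕ; zero; suc; _+_; _*_; _∸_; _≤_; _<_; s≤s; s≤s⁻¹; _<?_; _≤?_; _≟_; NonZero)
open import Data.Nat.Properties
open import Data.Nat.Induction using (<-rec)
open import Data.Nat.DivMod
  using (_%_; _/_; m%n<n; m≡m%n+[m/n]*n; [m+kn]%n≡m%n; [m+n]%n≡m%n; m<n⇒m%n≡m)
open import Data.Nat.ListAction using (product)
open import Algebra.Properties.CommutativeSemigroup +-commutativeSemigroup using (xy∙z≈xz∙y)
open import Data.Fin using (Fin; toℕ; combine; fromℕ<)
  renaming (zero to fzero; suc to fsuc; _≟_ to _≟ᶠ_)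
open import Data.Fin.Properties
  using ( any?; pigeonhole; combine-injective; toℕ-injective; toℕ<n; toℕ≤pred[n]
        ; toℕ-fromℕ<; fromℕ<-cong; fromℕ<-injective)
open import Data.List using (length; allFin)
open import Data.List.Properties using (map-tabulate; filter-none; filter-≐)
open import Data.List.Relation.Unary.All.Properties using (tabulate⁺)
open import Data.Product using (∃; ∃₂; Σ; _×_; _,_; proj₁; proj₂)
open import Relation.Nullary using (¬_; yes; no; contradiction)
open import Relation.Nullary.Decidable using (_×-dec_)
open import Relation.Unary using (Pred; Decidable)
open import Relation.Binary.PropositionalEquality using (_≡_; refl; sym; trans; cong; subst)
open import Relation.Binary.PropositionalEquality.Properties using (subst-injective)

private
  variable
    ℓ : Level

Least : Pred ℕ ℓ → Pred ℕ ℓ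
Least P x = P x × (∀ {y} → P y → x ≤ y)

Greatest : Pred ℕ ℓ → Pred ℕ ℓ
Greatest P x = P x × (∀ {y} → P y → y ≤ x)

module _ {P : Pred ℕ ℓ} (P? : Decidable P) where

  least : ∀ {x} → P x → ∃ (Least P)
  least {x} = <-rec (λ x → P x → ∃ (Least P)) step x
    where
    step : ∀ x → (∀ {y} → y < x → P y → ∃ (Least P)) → P x → ∃ (Least P)
    step x rec px with anyUpTo? P? x
    ... | yes (y , y<x , py) = rec y<x py
    ... | no ∄ = x , px , λ {y} py → ≮⇒≥ λ y<x → ∄ (y , y<x , py)

  greatest : ∀ {x b} → P x → (∀ {y} → P y → y < b) → ∃ (Greatest P)
  greatest {b = zero} px bounded = contradiction (bounded px) λ ()
  greatest {b = suc b} px bounded with P? b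
  ... | yes pb = b , pb , λ py → <⇒≤pred (bounded py)
  ... | no ¬pb = greatest {b = b} px λ py → ≤∧≢⇒< (<⇒≤pred (bounded py)) λ { refl → ¬pb py }

least-offset≤ : {P : Pred ℕ ℓ} {t x j : ℕ} → Least (λ z → P (t + z)) x → t ≤ j → P j → t + x ≤ j
least-offset≤ {P = P} {t} {x} {j} (_ , minimal) t≤j pj =
  subst (t + x ≤_) (m+[n∸m]≡n t≤j) (+-monoʳ-≤ t (minimal (subst P (sym (m+[n∸m]≡n t≤j)) pj)))

module _ {P : Pred ℕ ℓ} (P? : Decidable P) (d : ℕ)
  (first : ∀ {j} → P j → (∀ {j'} → j' < j → ¬ P j') → j < d)
  (gap : ∀ {j j'} → P j → P j' → j < j' → (∀ {j''} → j < j'' → j'' < j' → ¬ P j'') → j' ≤ j + d)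
  where

  visited-within : ∀ {J} → P J → ∀ t → t ≤ J → ∃ λ x → x < d × P (t + x)
  visited-within pJ zero _ with least P? pJ
  ... | x , px , minimal = x , first px (λ y<x py → <⇒≱ y<x (minimal py)) , px
  visited-within pJ (suc t) t<J with visited-within pJ t (<⇒≤ t<J)
  ... | suc x , x<d , px = x , <⇒≤ x<d , subst P (+-suc t x) px
  ... | zero , _ , pt with least (λ z → P? (suc t + z)) (subst P (sym (m+[n∸m]≡n t<J)) pJ)
  ...   | z , next = z , +-cancelˡ-< t z d next≤ , proj₁ next
    where
    next≤ : suc t + z ≤ t + d
    next≤ = gap (subst P (+-identityʳ t) pt) (proj₁ next) (s≤s (m≤m+n t z))
      λ t<j j<next pj → <⇒≱ j<next (least-offset≤ {P = P} next t<j pj)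

Hit : {A : Set} → (ℕ → A) → ℕ → A → ℕ → Set
Hit σ w a start = ∃ λ t → start ≤ t × t < start + w × σ t ≡ a

hit-from-one-period : {A : Set} (M : ℕ) .{{_ : NonZero M}} (σ : ℕ → A) (w : ℕ) (a : A) →
  (∀ c t → σ (t + c * M) ≡ σ t) → (∀ r → r < M → Hit σ w a r) → ∀ start → Hit σ w a start
hit-from-one-period M σ w a periodic hit start with hit (start % M) (m%n<n start M)
... | t , r≤t , t<r+w , σt≡a = t + Q * M , start≤ , <start+w , trans (periodic Q t) σt≡a
  where
  Q = start / M
  r = start % M
  start≡r+QM : start ≡ r + Q * M
  start≡r+QM = m≡m%n+[m/n]*n start M
  start≤ : start ≤ t + Q * M
  start≤ = subst (_≤ t + Q * M) (sym start≡r+QM) (+-monoˡ-≤ (Q * M) r≤t)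
  <start+w : t + Q * M < start + w
  <start+w = begin-strict
    t + Q * M     <⟨ +-monoˡ-< (Q * M) t<r+w ⟩
    r + w + Q * M ≡⟨ xy∙z≈xz∙y r w (Q * M) ⟩
    r + Q * M + w ≡⟨ cong (_+ w) start≡r+QM ⟨
    start + w     ∎
    where open ≤-Reasoning hiding (start)

prodD-suc : ∀ n (d : Fin (suc n) → ℕ) → prodD (suc n) d ≡ d fzero * prodD n (d ∘ fsuc)
prodD-suc n d = cong (λ ds → d fzero * product ds)
  (trans (map-tabulate fsuc d) (sym (map-tabulate id (d ∘ fsuc))))

encode : ∀ {n} (d : Fin n → ℕ) → ((i : Fin n) → Fin (d i)) → Fin (prodD n d)
encode {zero} d r = fzero
encode {suc n} d r =
  subst Fin (sym (prodD-suc n d)) (combine (r fzero) (encode (d ∘ fsuc) (r ∘ fsuc)))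

encode-injective : ∀ {n} (d : Fin n → ℕ) (r r' : (i : Fin n) → Fin (d i)) →
  encode d r ≡ encode d r' → ∀ i → r i ≡ r' i
encode-injective {suc n} d r r' eq i
  with combine-injective (r fzero) _ (r' fzero) _ (subst-injective (sym (prodD-suc n d)) eq)
... | r₀≡r'₀ , rest with i
...   | fzero = r₀≡r'₀
...   | fsuc i = encode-injective (d ∘ fsuc) (r ∘ fsuc) (r' ∘ fsuc) rest i

module _ {n L : ℕ} (s : Fin L → Fin n) where

  Visit : Fin n → Pred ℕ 0ℓ
  Visit i j = ∃ λ f → toℕ f ≡ j × s f ≡ i

  visit? : ∀ i → Decidable (Visit i)
  visit? i j = any? λ f → (toℕ f ≟ j) ×-dec (s f ≟ᶠ i)

  NextVisitOffset : Fin n → ℕ → Pred ℕ 0ℓ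
  NextVisitOffset i t = Least (λ z → Visit i (t + z))

  SameNextVisits : ℕ → ℕ → Set
  SameNextVisits a b = ∀ i → ∃ λ y → NextVisitOffset i a y × NextVisitOffset i b y

  repeatSeg-visit : ∀ {p q i t} (p≤q : p ≤ q) (q<L : q < L) →
    Visit i (segIdx p q t) → repeatSeg s p q p≤q q<L t ≡ i
  repeatSeg-visit p≤q q<L (f , toℕf≡ , sf≡i) =
    trans (cong s (toℕ-injective (trans (toℕ-fromℕ< _) (sym toℕf≡)))) sf≡i

  repeatSeg-pinwheel : ∀ {d : Fin n → ℕ} {p q} (p≤q : p ≤ q) (q<L : q < L) →
    SameNextVisits p (suc q) →
    (∀ i u → p ≤ u → u ≤ q → ∃ λ x → x < d i × Visit i (u + x)) →
    PinwheelFeasible n d (repeatSeg s p q p≤q q<L)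
  repeatSeg-pinwheel {d} {p} {q} p≤q q<L same-next visited i with same-next i
  ... | y , (p+y , _) , next-from-1+q = hit-from-one-period M σ (d i) i periodic one-period
    where
    M = suc (q ∸ p)
    σ = repeatSeg s p q p≤q q<L
    p+M≡1+q : p + M ≡ suc q
    p+M≡1+q = trans (+-suc p (q ∸ p)) (cong suc (m+[n∸m]≡n p≤q))
    periodic : ∀ c t → σ (t + c * M) ≡ σ t
    periodic c t = cong s (fromℕ<-cong _ _ (cong (p +_) ([m+kn]%n≡m%n t c M)) _ _)
    σ-visit : ∀ t {w} → t % M ≡ w → Visit i (p + w) → σ t ≡ i
    σ-visit t t%M≡w v = repeatSeg-visit {t = t} p≤q q<L (subst (Visit i ∘ (p +_)) (sym t%M≡w) v)
    -- otherwise the visit at p + y would come before the first visit at or after 1 + q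
    y<M : y < M
    y<M = ≰⇒> λ M≤y → <⇒≱ (+-monoˡ-< y (s≤s p≤q))
      (least-offset≤ {P = Visit i} next-from-1+q (subst (_≤ p + y) p+M≡1+q (+-monoʳ-≤ p M≤y)) p+y)
    one-period : ∀ r → r < M → Hit σ (d i) i r
    one-period r r<M
      with visited i (p + r) (m≤m+n p r) (s≤s⁻¹ (subst (p + r <_) p+M≡1+q (+-monoʳ-< p r<M)))
    ... | x , x<d , v with r + x <? M
    ...   | yes r+x<M = r + x , m≤m+n r x , +-monoʳ-< r x<d ,
            σ-visit (r + x) (m<n⇒m%n≡m r+x<M) (subst (Visit i) (+-assoc p r x) v)
    ...   | no r+x≮M = y + M , ≤-trans (<⇒≤ r<M) (m≤n+m M y) , y+M<r+d ,
            σ-visit (y + M) (trans ([m+n]%n≡m%n y M) (m<n⇒m%n≡m y<M)) p+y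
      where
      open ≤-Reasoning
      1+q≤p+r+x : suc q ≤ p + r + x
      1+q≤p+r+x = begin
        suc q       ≡⟨ p+M≡1+q ⟨
        p + M       ≤⟨ +-monoʳ-≤ p (≮⇒≥ r+x≮M) ⟩
        p + (r + x) ≡⟨ +-assoc p r x ⟨
        p + r + x   ∎
      M+y≤r+x : M + y ≤ r + x
      M+y≤r+x = +-cancelˡ-≤ p (M + y) (r + x) (begin
        p + (M + y) ≡⟨ +-assoc p M y ⟨
        p + M + y   ≡⟨ cong (_+ y) p+M≡1+q ⟩
        suc q + y   ≤⟨ least-offset≤ {P = Visit i} next-from-1+q 1+q≤p+r+x v ⟩
        p + r + x   ≡⟨ +-assoc p r x ⟩
        p + (r + x) ∎)
      y+M<r+d : y + M < r + d i
      y+M<r+d = begin-strict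
        y + M   ≡⟨ +-comm y M ⟩
        M + y   ≤⟨ M+y≤r+x ⟩
        r + x   <⟨ +-monoʳ-< r x<d ⟩
        r + d i ∎

module _ {n k : ℕ} {d : Fin n → ℕ} {s : Fin (n * k) → Fin n} (F : KVisitsFeasible n k d s) where
  open KVisitsFeasible F

  first-visit-< : ∀ {i j} → Visit s i j → (∀ {j'} → j' < j → ¬ Visit s i j') → j < d i
  first-visit-< (f , refl , sf≡i) none =
    firstWithin _ f sf≡i λ f' f'<f sf'≡i → none f'<f (f' , refl , sf'≡i)

  next-visit-≤ : ∀ {i j j'} → Visit s i j → Visit s i j' → j < j' →
    (∀ {j''} → j < j'' → j'' < j' → ¬ Visit s i j'') → j' ≤ j + d i
  next-visit-≤ (f , refl , sf≡i) (f' , refl , sf'≡i) f<f' none =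
    gapWithin _ f f' sf≡i sf'≡i f<f' λ f'' f<f'' f''<f' sf''≡i →
      none f<f'' f''<f' (f'' , refl , sf''≡i)

  visit-exists : 1 ≤ k → ∀ i → ∃ (Visit s i)
  visit-exists 1≤k i with any? (λ f → s f ≟ᶠ i)
  ... | yes (f , sf≡i) = toℕ f , f , refl , sf≡i
  ... | no ∄ = contradiction (trans (sym (cong length no-visits)) (exactlyK i)) (<⇒≢ 1≤k)
    where
    no-visits = filter-none (λ f → s f ≟ᶠ i) (tabulate⁺ λ f sf≡i → ∄ (f , sf≡i))

  last-visit-late : 1 ≤ k →
    (∀ i j → s j ≡ i → visitsUpTo s i j ≡ k → prodD n d ≤ toℕ j) →
    ∀ i → ∃ λ J → Visit s i J × prodD n d ≤ J
  last-visit-late 1≤k late i with visit-exists 1≤k i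
  ... | _ , v with greatest (visit? s i) v (λ { (f , refl , _) → toℕ<n f })
  ...   | _ , (f , refl , sf≡i) , maximal =
    toℕ f , (f , refl , sf≡i) , late i f sf≡i all-visits-up-to-f
    where
    all-visits-up-to-f : visitsUpTo s i f ≡ k
    all-visits-up-to-f = trans
      (cong length (filter-≐ (λ f' → (toℕ f' ≤? toℕ f) ×-dec (s f' ≟ᶠ i)) (λ f' → s f' ≟ᶠ i)
        (proj₂ , λ sf'≡i → maximal (_ , refl , sf'≡i) , sf'≡i) (allFin (n * k))))
      (exactlyK i)

module _ {n k : ℕ} {d : Fin n → ℕ} {s : Fin (n * k) → Fin n}
  (F : KVisitsFeasible n k d s) (1≤k : 1 ≤ k)
  (late : ∀ i j → s j ≡ i → visitsUpTo s i j ≡ k → prodD n d ≤ toℕ j)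
  where

  prodD<length : 1 ≤ n → prodD n d < n * k
  prodD<length 1≤n with last-visit-late F 1≤k late (fromℕ< 1≤n)
  ... | _ , (f , refl , _) , m≤f = ≤-<-trans m≤f (toℕ<n f)

  visited-within-deadline : ∀ i t → t ≤ prodD n d → ∃ λ x → x < d i × Visit s i (t + x)
  visited-within-deadline i t t≤m with last-visit-late F 1≤k late i
  ... | J , vJ , m≤J =
    visited-within (visit? s i) (d i) (first-visit-< F) (next-visit-≤ F) vJ t (≤-trans t≤m m≤J)

  next-offset : ∀ {t} → t ≤ prodD n d → ∀ i → ∃ λ y → y < d i × NextVisitOffset s i t y
  next-offset {t} t≤m i with visited-within-deadline i t t≤m
  ... | x , x<d , v with least (λ z → visit? s i (t + z)) v
  ...   | y , next = y , ≤-<-trans (proj₂ next v) x<d , next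

  state : Fin (suc (prodD n d)) → (i : Fin n) → Fin (d i)
  state t i = fromℕ< (proj₁ (proj₂ (next-offset (toℕ≤pred[n] t) i)))

  repeated-state : ∃₂ λ a b → a < b × b ≤ prodD n d × SameNextVisits s a b
  repeated-state with pigeonhole (n<1+n _) (encode d ∘ state)
  ... | t , t' , t<t' , same-code = toℕ t , toℕ t' , t<t' , toℕ≤pred[n] t' , same-next
    where
    same-next : SameNextVisits s (toℕ t) (toℕ t')
    same-next i =
      proj₁ o , proj₂ (proj₂ o) , subst (NextVisitOffset s i _) (sym y≡y') (proj₂ (proj₂ o'))
      where
      o = next-offset (toℕ≤pred[n] t) i
      o' = next-offset (toℕ≤pred[n] t') i
      y≡y' : proj₁ o ≡ proj₁ o'
      y≡y' = fromℕ<-injective _ _ _ _ (encode-injective d (state t) (state t') same-code i)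

  pinwheel-segment : 1 ≤ n → ∀ {p b} → p < b → b ≤ prodD n d → SameNextVisits s p b →
    ∃ λ q → Σ (p ≤ q) λ p≤q → Σ (q < n * k) λ q<L →
      q < prodD n d × PinwheelFeasible n d (repeatSeg s p q p≤q q<L)
  pinwheel-segment 1≤n {p} {suc q} (s≤s p≤q) q<m same-next =
    q , p≤q , q<L , q<m , repeatSeg-pinwheel s p≤q q<L same-next visited
    where
    q<L : q < n * k
    q<L = <-trans q<m (prodD<length 1≤n)
    visited : ∀ i u → p ≤ u → u ≤ q → ∃ λ x → x < d i × Visit s i (u + x)
    visited i u _ u≤q = visited-within-deadline i u (≤-trans u≤q (<⇒≤ q<m))

lemma15 : (n k : ℕ) → 1 ≤ n → 1 ≤ k →
    (d : Fin n → ℕ) → (∀ i → 1 ≤ d i) →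
    (s : Fin (n * k) → Fin n) → KVisitsFeasible n k d s →
    (∀ (i : Fin n) (j : Fin (n * k)) → s j ≡ i → visitsUpTo s i j ≡ k →
      prodD n d ≤ toℕ j) →
    ∃₂ λ (p q : ℕ) → Σ (p ≤ q) λ p≤q → Σ (q < n * k) λ q<L →
      q < prodD n d × PinwheelFeasible n d (repeatSeg s p q p≤q q<L)
-- Positive deadlines are implied by feasibility (a first visit precedes d i), hence unused.
lemma15 n k 1≤n 1≤k d _ s F late =
  let (p , b , p<b , b≤m , same-next) = repeated-state F 1≤k late
  in p , pinwheel-segment F 1≤k late 1≤n p<b b≤m same-next
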